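{- For all integers $p,q\ge 1$: (i) $Z(p,q)=Z(q,p)$; (ii) in general $Z_e(p,q)\neq Z_e(q,p)$, i.e. there exist $p,q$ with $Z_e(p,q)\ne Z_e(q,p)$; (iii) $Z_t(p,q)=Z_t(q,p)$. Here, with $n=pq$: $Z(p,q)$ is the number of $n\times n$ permutation matrices $P$ such that $P^{\Gamma_p}$ is a permutation matrix; $Z_e(p,q)$ is the number of $n\times n$ permutation matrices $P$ with $P^{\Gamma_p}=P$; $Z_t(p,q)$ is the number of $n\times n$ involutions $P$ such that $P^{\Gamma_p}$ is a permutation matrix.
   Context: A permutation matrix of size $n$ is an $n\times n$ $\{0,1\}$-matrix with exactly one $1$ in each row and each column. An involution is a permutation matrix $P$ with $P=P^T$ and $P$ not the identity matrix. For an $n\times n$ matrix $M$ with $n=pq$, view $M$ as a $p\times p$ array of $q\times q$ blocks $\mathcal{B}_{i,j}$; the partial transpose $M^{\Gamma_p}$ is the matrix obtained by replacing each block $\mathcal{B}_{i,j}$ by its transpose $\mathcal{B}_{i,j}^T$, keeping blocks in place. (Note that $Z(q,p)$, $Z_e(q,p)$, $Z_t(q,p)$ refer to the same $n=qp$ but with the matrix viewed as a $q\times q$ array of $p\times p$ blocks.) -}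

module Defs where

open import Data.Nat using (ℕ; zero; suc; _+_; _*_)
open import Data.Nat.Properties using (_≟_)
open import Data.Bool using (Bool; true; false; if_then_else_)
open import Data.Bool.Properties using () renaming (_≟_ to _≟ᵇ_)
open import Data.Fin using (Fin; zero; suc; remQuot; combine) renaming (_≟_ to _≟ᶠ_)
open import Data.Fin.Properties using (all?; any?)
open import Data.Product using (_×_; _,_; ∃)
open import Data.List using (List; []; _∷_; map; concatMap; filter; length)
open import Relation.Binary.PropositionalEquality using (_≡_)
open import Relation.Nullary using (¬_; Dec; yes; no; _×-dec_; ¬?)
open import Relation.Nullary.Decidable using (⌊_⌋)
open import Relation.Unary using (Pred; Decidable)

-- An n×n {0,1}-matrix (true = 1, false = 0).
Mat : ℕ → Set
Mat n = Fin n → Fin n → Bool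

countOnes : ∀ {n} → (Fin n → Bool) → ℕ
countOnes {zero}  v = 0
countOnes {suc n} v = (if v zero then 1 else 0) + countOnes (λ j → v (suc j))

IsPermMat : ∀ {n} → Mat n → Set
IsPermMat {n} M = (∀ i → countOnes (λ j → M i j) ≡ 1) × (∀ j → countOnes (λ i → M i j) ≡ 1)

idMat : ∀ {n} → Mat n
idMat i j = ⌊ i ≟ᶠ j ⌋

transpose : ∀ {n} → Mat n → Mat n
transpose M i j = M j i

_≋_ : ∀ {n} → Mat n → Mat n → Set
_≋_ {n} M N = ∀ i j → M i j ≡ N i j

IsInvolution : ∀ {n} → Mat n → Set
IsInvolution M = IsPermMat M × (M ≋ transpose M) × ¬ (M ≋ idMat)

-- Partial transpose Γ_p of an (p*q)×(p*q) matrix viewed as a p×p array of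
-- q×q blocks. Index combine a b (a : Fin p block index, b : Fin q position
-- within block) corresponds to a*q + b. Entry (b,d) of block (a,c) is moved
-- to entry (d,b) of the same block.
partialTranspose : (p q : ℕ) → Mat (p * q) → Mat (p * q)
partialTranspose p q M i j with remQuot {p} q i | remQuot {p} q j
... | a , b | c , d = M (combine a d) (combine c b)

allFuns : ∀ {A : Set} → List A → (n : ℕ) → List (Fin n → A)
allFuns xs zero    = (λ ()) ∷ []
allFuns xs (suc n) = concatMap (λ x → map (λ f → λ { zero → x ; (suc k) → f k }) (allFuns xs n)) xs

allMats : (n : ℕ) → List (Mat n)
allMats n = allFuns (allFuns (false ∷ true ∷ []) n) n

≋? : ∀ {n} (M N : Mat n) → Dec (M ≋ N)
≋? M N = all? (λ i → all? (λ j → M i j ≟ᵇ N i j))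

isPermMat? : ∀ {n} (M : Mat n) → Dec (IsPermMat M)
isPermMat? M = all? (λ i → countOnes (λ j → M i j) ≟ 1) ×-dec all? (λ j → countOnes (λ i → M i j) ≟ 1)

isInvolution? : ∀ {n} (M : Mat n) → Dec (IsInvolution M)
isInvolution? M = isPermMat? M ×-dec (≋? M (transpose M) ×-dec ¬? (≋? M idMat))

Z : ℕ → ℕ → ℕ
Z p q = length (filter (λ M → isPermMat? M ×-dec isPermMat? (partialTranspose p q M)) (allMats (p * q)))

Ze : ℕ → ℕ → ℕ
Ze p q = length (filter (λ M → isPermMat? M ×-dec ≋? (partialTranspose p q M) M) (allMats (p * q)))

Zt : ℕ → ℕ → ℕ
Zt p q = length (filter (λ M → isInvolution? M ×-dec isPermMat? (partialTranspose p q M)) (allMats (p * q)))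

module Submission where

-- Relabelling the rows and columns of a (pq)×(pq) matrix M along the
-- "block swap" permutation σ : b·p + a ↦ a·q + b of indices (a < p, b < q), i.e.
-- passing to M^σ = (M (σ i) (σ j))ᵢⱼ, turns the view of M as a p×p array of q×q
-- blocks into the view as a q×q array of p×p blocks, and the key identity is
-- Γ_q (M^σ) = ((Γ_p M)ᵀ)^σ.  Relabelling along a permutation and transposing
-- preserve permutation matrices (and involutions), so M ↦ M^σ matches the matrices
-- counted by Z(p,q) with those counted by Z(q,p), and likewise for Z_t; this gives
-- (i) and (iii).  For (ii), Γ_1 is the full transpose while Γ_3 on 3×3 matrices
-- (1×1 blocks) is the identity, so Z_e(1,3) = 4 (symmetric 3×3 permutation
-- matrices) differs from Z_e(3,1) = 3! = 6, which is decided by evaluation.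
--
-- Matrices are functions, so "matching" is made precise up to pointwise equality ≋.

open import Defs
open import Algebra.Properties.CommutativeSemigroup using (interchange)
open import Data.Bool using (Bool; true; false; if_then_else_)
open import Data.Bool.Properties using () renaming (_≟_ to _≟ᵇ_)
open import Data.Fin using (Fin; zero; suc; _≟_; remQuot; combine)
open import Data.Fin.Permutation using (Permutation; _⟨$⟩ʳ_; inverseʳ; flip)
open import Data.Fin.Properties using (all?; ∀-cons-⇔; remQuot-combine; combine-remQuot; *↔×)
open import Data.List using (List; []; _∷_; map; concatMap; filter; length; _++_)
open import Data.Nat using (ℕ; _+_; _*_; _≤_; s≤s; z≤n)
open import Data.Nat.Properties
  using (+-assoc; +-identityʳ; *-comm; *-zeroʳ; *-identityʳ; *-distribˡ-+;
         +-commutativeSemigroup; +-0-commutativeMonoid)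
open import Algebra.Properties.CommutativeMonoid.Sum +-0-commutativeMonoid using (sum; sum-permute)
open import Data.Product using (_×_; _,_; proj₁; proj₂; ∃-syntax; swap; uncurry)
open import Data.Product.Algebra using (×-comm)
open import Data.Product.Function.NonDependent.Propositional using (_×-⇔_)
open import Data.Vec.Functional.Relation.Binary.Pointwise using (Pointwise)
open import Function using (_∘_; id; _⇔_; mk⇔; Injection)
open import Function.Properties.Equivalence using () renaming (sym to ⇔-sym)
open import Function.Properties.Inverse using (↔-trans; ↔-sym; ↔⇒↣)
open import Level using (Level)
open import Relation.Binary.Core using (Rel)
open import Relation.Binary.Definitions using (Symmetric) renaming (Decidable to Decidable₂)
open import Relation.Binary.PropositionalEquality
  using (_≡_; _≢_; refl; sym; trans; cong; cong₂; subst₂; module ≡-Reasoning)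
open import Relation.Nullary using (¬_; Dec; yes; no; does; _×-dec_; contradiction)
open import Relation.Nullary.Decidable using (does-⇔; isYes≗does; ⌊_⌋)
open import Relation.Unary using (Pred; Decidable)

private
  variable
    a p r : Level
    A B : Set a
    m n : ℕ

⟦_⟧ : {P : Set p} → Dec P → ℕ
⟦ P? ⟧ = if does P? then 1 else 0

⟦⟧-⇔ : {P : Set p} {Q : Set r} → P ⇔ Q → (P? : Dec P) (Q? : Dec Q) → ⟦ P? ⟧ ≡ ⟦ Q? ⟧
⟦⟧-⇔ P⇔Q P? Q? = cong (λ b → if b then 1 else 0) (does-⇔ P⇔Q P? Q?)

⟦×-dec⟧ : {P : Set p} {Q : Set r} (P? : Dec P) (Q? : Dec Q) →
          ⟦ P? ×-dec Q? ⟧ ≡ ⟦ P? ⟧ * ⟦ Q? ⟧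
⟦×-dec⟧ (yes _) Q? = sym (+-identityʳ ⟦ Q? ⟧)
⟦×-dec⟧ (no _)  Q? = refl

sumOver : (A → ℕ) → List A → ℕ
sumOver f []       = 0
sumOver f (x ∷ xs) = f x + sumOver f xs

count : {P : Pred A p} → Decidable P → List A → ℕ
count P? = sumOver (λ x → ⟦ P? x ⟧)

length-filter : {P : Pred A p} (P? : Decidable P) (xs : List A) →
                length (filter P? xs) ≡ count P? xs
length-filter P? []       = refl
length-filter P? (x ∷ xs) with P? x
... | yes _ = cong ℕ.suc (length-filter P? xs)
... | no _  = length-filter P? xs

sumOver-cong : {f g : A → ℕ} → (∀ x → f x ≡ g x) → ∀ xs → sumOver f xs ≡ sumOver g xs
sumOver-cong f≗g []       = refl
sumOver-cong f≗g (x ∷ xs) = cong₂ _+_ (f≗g x) (sumOver-cong f≗g xs)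

sumOver-map : (f : B → ℕ) (h : A → B) (xs : List A) →
              sumOver f (map h xs) ≡ sumOver (f ∘ h) xs
sumOver-map f h []       = refl
sumOver-map f h (x ∷ xs) = cong (f (h x) +_) (sumOver-map f h xs)

sumOver-++ : (f : A → ℕ) (xs ys : List A) →
             sumOver f (xs ++ ys) ≡ sumOver f xs + sumOver f ys
sumOver-++ f []       ys = refl
sumOver-++ f (x ∷ xs) ys =
  trans (cong (f x +_) (sumOver-++ f xs ys)) (sym (+-assoc (f x) _ _))

sumOver-concatMap : (f : B → ℕ) (g : A → List B) (xs : List A) →
                    sumOver f (concatMap g xs) ≡ sumOver (sumOver f ∘ g) xs
sumOver-concatMap f g []       = refl
sumOver-concatMap f g (x ∷ xs) =
  trans (sumOver-++ f (g x) (concatMap g xs))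
        (cong (sumOver f (g x) +_) (sumOver-concatMap f g xs))

sumOver-+ : (f g : A → ℕ) (xs : List A) →
            sumOver (λ x → f x + g x) xs ≡ sumOver f xs + sumOver g xs
sumOver-+ f g []       = refl
sumOver-+ f g (x ∷ xs) =
  trans (cong (f x + g x +_) (sumOver-+ f g xs))
        (interchange +-commutativeSemigroup (f x) (g x) (sumOver f xs) (sumOver g xs))

sumOver-*ˡ : (c : ℕ) (f : A → ℕ) (xs : List A) →
             sumOver (λ x → c * f x) xs ≡ c * sumOver f xs
sumOver-*ˡ c f []       = sym (*-zeroʳ c)
sumOver-*ˡ c f (x ∷ xs) =
  trans (cong (c * f x +_) (sumOver-*ˡ c f xs)) (sym (*-distribˡ-+ c (f x) _))

-- Fubini for finite double sums; for xs = [] both sides vanish, a sum of zeros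
-- being 0 · (a sum) = 0.
sumOver-swap : (f : A → B → ℕ) (xs : List A) (ys : List B) →
               sumOver (λ x → sumOver (f x) ys) xs ≡ sumOver (λ y → sumOver (λ x → f x y) xs) ys
sumOver-swap f []       ys = sym (sumOver-*ˡ 0 (λ _ → 0) ys)
sumOver-swap f (x ∷ xs) ys =
  trans (cong (sumOver (f x) ys +_) (sumOver-swap f xs ys))
        (sym (sumOver-+ (f x) (λ y → sumOver (λ x → f x y) xs) ys))

count-cong : {P Q : Pred A p} (P? : Decidable P) (Q? : Decidable Q) →
             (∀ x → P x ⇔ Q x) → ∀ xs → count P? xs ≡ count Q? xs
count-cong P? Q? P⇔Q = sumOver-cong (λ x → ⟦⟧-⇔ (P⇔Q x) (P? x) (Q? x))

count-×-dec : {P : Set p} {Q : Pred A r} (P? : Dec P) (Q? : Decidable Q) (xs : List A) →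
              count (λ x → P? ×-dec Q? x) xs ≡ ⟦ P? ⟧ * count Q? xs
count-×-dec P? Q? xs =
  trans (sumOver-cong (λ x → ⟦×-dec⟧ P? (Q? x)) xs) (sumOver-*ˡ ⟦ P? ⟧ (λ x → ⟦ Q? x ⟧) xs)

Enumerates : {A : Set a} {R : Rel A r} → Decidable₂ R → List A → Set a
Enumerates R? xs = ∀ a → count (R? a) xs ≡ 1

-- Double counting: two enumerations of A up to a symmetric relation R contain
-- equally many elements with any R-invariant property P, since both counts
-- equal Σ_{x ∈ xs} Σ_{y ∈ ys} [R x y] [P x].
enumerations-agree : {R : Rel A r} {P : Pred A p} (R? : Decidable₂ R) (P? : Decidable P) →
  Symmetric R → (∀ {x y} → R x y → P x → P y) →
  ∀ {xs ys} → Enumerates R? xs → Enumerates R? ys → count P? xs ≡ count P? ys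
enumerations-agree {R = R} {P} R? P? R-sym P-resp {xs} {ys} enum-xs enum-ys = begin
  count P? xs
    ≡⟨ sumOver-cong (λ x → sym (weight x ys (enum-ys x) ⟦ P? x ⟧)) xs ⟩
  sumOver (λ x → sumOver (λ y → ⟦ P? x ⟧ * ⟦ R? x y ⟧) ys) xs
    ≡⟨ sumOver-swap (λ x y → ⟦ P? x ⟧ * ⟦ R? x y ⟧) xs ys ⟩
  sumOver (λ y → sumOver (λ x → ⟦ P? x ⟧ * ⟦ R? x y ⟧) xs) ys
    ≡⟨ sumOver-cong (λ y → sumOver-cong (related-terms y) xs) ys ⟩
  sumOver (λ y → sumOver (λ x → ⟦ P? y ⟧ * ⟦ R? y x ⟧) xs) ys
    ≡⟨ sumOver-cong (λ y → weight y xs (enum-xs y) ⟦ P? y ⟧) ys ⟩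
  count P? ys ∎
  where
  open ≡-Reasoning
  weight : ∀ a zs → count (R? a) zs ≡ 1 → ∀ c →
           sumOver (λ z → c * ⟦ R? a z ⟧) zs ≡ c
  weight a zs one c =
    trans (sumOver-*ˡ c (λ z → ⟦ R? a z ⟧) zs) (trans (cong (c *_) one) (*-identityʳ c))
  related-terms : ∀ y x → ⟦ P? x ⟧ * ⟦ R? x y ⟧ ≡ ⟦ P? y ⟧ * ⟦ R? y x ⟧
  related-terms y x with R? x y | R? y x
  ... | no _    | no _    = trans (*-comm ⟦ P? x ⟧ 0) (*-comm 0 ⟦ P? y ⟧)
  ... | yes Rxy | no ¬Ryx = contradiction (R-sym Rxy) ¬Ryx
  ... | no ¬Rxy | yes Ryx = contradiction (R-sym Ryx) ¬Rxy
  ... | yes Rxy | yes Ryx = cong (_* 1) (⟦⟧-⇔ (mk⇔ (P-resp Rxy) (P-resp Ryx)) (P? x) (P? y))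

pointwise? : {R : Rel A r} → Decidable₂ R → ∀ {n} → Decidable₂ (Pointwise R {n})
pointwise? R? f g = all? (λ i → R? (f i) (g i))

count-extensions : {R : Rel A r} (R? : Decidable₂ R) {n : ℕ}
  (f : Fin (ℕ.suc n) → A) (extend : (Fin n → A) → Fin (ℕ.suc n) → A) (gs : List (Fin n → A)) →
  count (pointwise? R? f) (map extend gs) ≡
  count (λ g → R? (f zero) (extend g zero) ×-dec pointwise? R? (f ∘ suc) (extend g ∘ suc)) gs
count-extensions {R = R} R? f extend gs =
  trans (sumOver-map _ extend gs)
        (count-cong (pointwise? R? f ∘ extend) head-and-tail? head-and-tail gs)
  where
  head-and-tail? : Decidable (λ g → R (f zero) (extend g zero) ×
                                     Pointwise R (f ∘ suc) (extend g ∘ suc))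
  head-and-tail? g = R? (f zero) (extend g zero) ×-dec pointwise? R? (f ∘ suc) (extend g ∘ suc)
  head-and-tail : ∀ g → Pointwise R f (extend g) ⇔
                        (R (f zero) (extend g zero) × Pointwise R (f ∘ suc) (extend g ∘ suc))
  head-and-tail g = ⇔-sym (∀-cons-⇔ {P = λ i → R (f i) (extend g i)})

-- allFuns xs n enumerates Fin n → A up to pointwise R when xs enumerates A up to R:
-- a function f is matched by the extensions of g by x exactly when f zero
-- matches x and f ∘ suc matches g.
allFuns-enumerates : {R : Rel A r} (R? : Decidable₂ R) {xs : List A} →
  Enumerates R? xs → ∀ n → Enumerates (pointwise? R? {n}) (allFuns xs n)
allFuns-enumerates R? enum ℕ.zero f = refl
allFuns-enumerates R? {xs} enum (ℕ.suc n) f = begin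
  count (pointwise? R? f) (allFuns xs (ℕ.suc n))
    ≡⟨ trans (sumOver-concatMap _ _ xs) (sumOver-cong (λ x → count-extensions R? f _ gs) xs) ⟩
  sumOver (λ x → count (λ g → R? (f zero) x ×-dec pointwise? R? (f ∘ suc) g) gs) xs
    ≡⟨ sumOver-cong (λ x → count-×-dec (R? (f zero) x) (pointwise? R? (f ∘ suc)) gs) xs ⟩
  sumOver (λ x → ⟦ R? (f zero) x ⟧ * count (pointwise? R? (f ∘ suc)) gs) xs
    ≡⟨ sumOver-cong (λ x → cong (⟦ R? (f zero) x ⟧ *_) (allFuns-enumerates R? enum n (f ∘ suc)))
                    xs ⟩
  sumOver (λ x → ⟦ R? (f zero) x ⟧ * 1) xs
    ≡⟨ sumOver-cong (λ x → *-identityʳ _) xs ⟩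
  count (R? (f zero)) xs
    ≡⟨ enum (f zero) ⟩
  1 ∎
  where
  open ≡-Reasoning
  gs = allFuns xs n

-- allMats n lists every n×n {0,1}-matrix exactly once up to ≋, which is pointwise
-- equality of rows, themselves compared pointwise.
allMats-enumerates : ∀ n → Enumerates (≋? {n}) (allMats n)
allMats-enumerates n M =
  trans (count-cong (≋? M) (pointwise? (pointwise? _≟ᵇ_) M) (λ _ → mk⇔ id id) (allMats n))
        (allFuns-enumerates (pointwise? _≟ᵇ_) (allFuns-enumerates _≟ᵇ_ bools n) n M)
  where
  bools : Enumerates _≟ᵇ_ (false ∷ true ∷ [])
  bools false = refl
  bools true  = refl

countOnes-sum : (v : Fin n → Bool) → countOnes v ≡ sum (λ i → if v i then 1 else 0)
countOnes-sum {ℕ.zero}  v = refl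
countOnes-sum {ℕ.suc n} v = cong ((if v zero then 1 else 0) +_) (countOnes-sum (v ∘ suc))

countOnes-permute : (π : Permutation m n) (v : Fin n → Bool) →
                    countOnes (v ∘ (π ⟨$⟩ʳ_)) ≡ countOnes v
countOnes-permute π v = begin
  countOnes (v ∘ (π ⟨$⟩ʳ_))                     ≡⟨ countOnes-sum (v ∘ (π ⟨$⟩ʳ_)) ⟩
  sum (λ i → if v (π ⟨$⟩ʳ i) then 1 else 0)   ≡⟨ sum-permute (λ i → if v i then 1 else 0) π ⟨
  sum (λ i → if v i then 1 else 0)             ≡⟨ countOnes-sum v ⟨
  countOnes v                                  ∎
  where open ≡-Reasoning

countOnes-cong : {v w : Fin n → Bool} → (∀ i → v i ≡ w i) → countOnes v ≡ countOnes w
countOnes-cong {ℕ.zero}  v≗w = refl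
countOnes-cong {ℕ.suc n} v≗w =
  cong₂ (λ b k → (if b then 1 else 0) + k) (v≗w zero) (countOnes-cong (v≗w ∘ suc))

≋-sym : {M N : Mat n} → M ≋ N → N ≋ M
≋-sym M≋N i j = sym (M≋N i j)

≋-trans : {L M N : Mat n} → L ≋ M → M ≋ N → L ≋ N
≋-trans L≋M M≋N i j = trans (L≋M i j) (M≋N i j)

relabel : (Fin m → Fin n) → Mat n → Mat m
relabel f M i j = M (f i) (f j)

relabel-cong : (f : Fin m → Fin n) {M N : Mat n} → M ≋ N → relabel f M ≋ relabel f N
relabel-cong f M≋N i j = M≋N (f i) (f j)

relabel-inverse : (π : Permutation m n) (M : Mat n) →
                  relabel (flip π ⟨$⟩ʳ_) (relabel (π ⟨$⟩ʳ_) M) ≋ M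
relabel-inverse π M i j = cong₂ M (inverseʳ π) (inverseʳ π)

record RelabellingInvariant (S : ∀ {n} → Mat n → Set) : Set₁ where
  field
    respects : {M N : Mat n} → M ≋ N → S M → S N
    relabel⁺ : (π : Permutation m n) {M : Mat n} → S M → S (relabel (π ⟨$⟩ʳ_) M)

  relabel⁻ : (π : Permutation m n) {M : Mat n} → S (relabel (π ⟨$⟩ʳ_) M) → S M
  relabel⁻ π {M} = respects (relabel-inverse π M) ∘ relabel⁺ (flip π)

  relabel-⇔ : (π : Permutation m n) {M : Mat n} → S (relabel (π ⟨$⟩ʳ_) M) ⇔ S M
  relabel-⇔ π = mk⇔ (relabel⁻ π) (relabel⁺ π)

open RelabellingInvariant

×-invariant : {S T : ∀ {n} → Mat n → Set} → RelabellingInvariant S → RelabellingInvariant T →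
              RelabellingInvariant (λ M → S M × T M)
×-invariant S-inv T-inv = record
  { respects = λ M≋N (s , t) → respects S-inv M≋N s , respects T-inv M≋N t
  ; relabel⁺ = λ π (s , t) → relabel⁺ S-inv π s , relabel⁺ T-inv π t
  }

¬-invariant : {S : ∀ {n} → Mat n → Set} → RelabellingInvariant S →
              RelabellingInvariant (λ M → ¬ S M)
¬-invariant S-inv = record
  { respects = λ M≋N ¬sM sN → ¬sM (respects S-inv (≋-sym M≋N) sN)
  ; relabel⁺ = λ π ¬sM sπM → ¬sM (relabel⁻ S-inv π sπM)
  }

-- Relabelling permutes the entries of each row and each column.
isPermMat-invariant : RelabellingInvariant IsPermMat
isPermMat-invariant = record
  { respects = λ M≋N (rows , cols) →
      (λ i → trans (countOnes-cong (λ j → sym (M≋N i j))) (rows i)) ,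
      (λ j → trans (countOnes-cong (λ i → sym (M≋N i j))) (cols j))
  ; relabel⁺ = λ π {M} (rows , cols) →
      (λ i → trans (countOnes-permute π (M (π ⟨$⟩ʳ i))) (rows (π ⟨$⟩ʳ i))) ,
      (λ j → trans (countOnes-permute π (λ i → M i (π ⟨$⟩ʳ j))) (cols (π ⟨$⟩ʳ j)))
  }

isPermMat-transpose : {M : Mat n} → IsPermMat M → IsPermMat (transpose M)
isPermMat-transpose (rows , cols) = cols , rows

symmetric-invariant : RelabellingInvariant (λ M → M ≋ transpose M)
symmetric-invariant = record
  { respects = λ M≋N M≋Mᵀ i j → trans (sym (M≋N i j)) (trans (M≋Mᵀ i j) (M≋N j i))
  ; relabel⁺ = λ π M≋Mᵀ i j → M≋Mᵀ (π ⟨$⟩ʳ i) (π ⟨$⟩ʳ j)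
  }

-- Relabelling the identity along a permutation, an injective map, gives the identity.
relabel-idMat : (π : Permutation m n) → relabel (π ⟨$⟩ʳ_) idMat ≋ idMat
relabel-idMat π i j = begin
  ⌊ π ⟨$⟩ʳ i ≟ π ⟨$⟩ʳ j ⌋    ≡⟨ isYes≗does (π ⟨$⟩ʳ i ≟ π ⟨$⟩ʳ j) ⟩
  does (π ⟨$⟩ʳ i ≟ π ⟨$⟩ʳ j) ≡⟨ does-⇔ π-injective⇔ (π ⟨$⟩ʳ i ≟ π ⟨$⟩ʳ j) (i ≟ j) ⟩
  does (i ≟ j)               ≡⟨ isYes≗does (i ≟ j) ⟨
  ⌊ i ≟ j ⌋                  ∎
  where
  open ≡-Reasoning
  π-injective⇔ : π ⟨$⟩ʳ i ≡ π ⟨$⟩ʳ j ⇔ i ≡ j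
  π-injective⇔ = mk⇔ (Injection.injective (↔⇒↣ π)) (cong (π ⟨$⟩ʳ_))

identity-invariant : RelabellingInvariant (λ M → M ≋ idMat)
identity-invariant = record
  { respects = λ M≋N M≋I → ≋-trans (≋-sym M≋N) M≋I
  ; relabel⁺ = λ π {M} M≋I → ≋-trans (relabel-cong (π ⟨$⟩ʳ_) M≋I) (relabel-idMat π)
  }

isInvolution-invariant : RelabellingInvariant IsInvolution
isInvolution-invariant =
  ×-invariant isPermMat-invariant (×-invariant symmetric-invariant (¬-invariant identity-invariant))

-- Relabelling every matrix of an enumeration along a permutation yields again
-- an enumeration: A ≋ relabel π M exactly when relabel π⁻¹ A ≋ M.
relabel-enumerates : (π : Permutation m n) → Enumerates ≋? (map (relabel (π ⟨$⟩ʳ_)) (allMats n))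
relabel-enumerates {n = n} π A = begin
  count (≋? A) (map (relabel (π ⟨$⟩ʳ_)) (allMats n))
    ≡⟨ sumOver-map (λ M → ⟦ ≋? A M ⟧) (relabel (π ⟨$⟩ʳ_)) (allMats n) ⟩
  count (≋? A ∘ relabel (π ⟨$⟩ʳ_)) (allMats n)
    ≡⟨ count-cong (≋? A ∘ relabel (π ⟨$⟩ʳ_)) (≋? (relabel (flip π ⟨$⟩ʳ_) A))
                  (λ M → mk⇔ (to M) (from M)) (allMats n) ⟩
  count (≋? (relabel (flip π ⟨$⟩ʳ_) A)) (allMats n)
    ≡⟨ allMats-enumerates n (relabel (flip π ⟨$⟩ʳ_) A) ⟩
  1 ∎
  where
  open ≡-Reasoning
  to : ∀ M → A ≋ relabel (π ⟨$⟩ʳ_) M → relabel (flip π ⟨$⟩ʳ_) A ≋ M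
  to M A≋πM = ≋-trans (relabel-cong (flip π ⟨$⟩ʳ_) A≋πM) (relabel-inverse π M)
  from : ∀ M → relabel (flip π ⟨$⟩ʳ_) A ≋ M → A ≋ relabel (π ⟨$⟩ʳ_) M
  from M π⁻¹A≋M = ≋-trans (≋-sym (relabel-inverse (flip π) A)) (relabel-cong (π ⟨$⟩ʳ_) π⁻¹A≋M)

count-relabel : {P : Mat m → Set} (P? : Decidable P) → (∀ {M N} → M ≋ N → P M → P N) →
                (π : Permutation m n) →
                count P? (allMats m) ≡ count (P? ∘ relabel (π ⟨$⟩ʳ_)) (allMats n)
count-relabel {m} {n} P? P-resp π =
  trans (enumerations-agree ≋? P? ≋-sym P-resp
           {xs = allMats m} {ys = map (relabel (π ⟨$⟩ʳ_)) (allMats n)}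
           (allMats-enumerates m) (relabel-enumerates π))
        (sumOver-map (λ M → ⟦ P? M ⟧) (relabel (π ⟨$⟩ʳ_)) (allMats n))

-- Every index of Fin (m * n) is of the form combine a b, so two matrices agree
-- as soon as they agree on all pairs of indices of that form.
≋-by-blocks : {M N : Mat (m * n)} →
              (∀ (a : Fin m) (b : Fin n) (c : Fin m) (d : Fin n) →
                M (combine a b) (combine c d) ≡ N (combine a b) (combine c d)) → M ≋ N
≋-by-blocks {m} {n} {M} {N} agree i j =
  subst₂ (λ i j → M i j ≡ N i j) (combine-remQuot {m} n i) (combine-remQuot {m} n j)
         (agree _ _ _ _)

partialTranspose-combine : ∀ p q (M : Mat (p * q)) a b c d →
  partialTranspose p q M (combine a b) (combine c d) ≡ M (combine a d) (combine c b)
partialTranspose-combine p q M a b c d =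
  cong₂ (λ (x y : Fin p × Fin q) → M (combine (proj₁ x) (proj₂ y)) (combine (proj₁ y) (proj₂ x)))
        (remQuot-combine a b) (remQuot-combine c d)

partialTranspose-cong : ∀ p q {M N : Mat (p * q)} → M ≋ N →
                        partialTranspose p q M ≋ partialTranspose p q N
partialTranspose-cong p q M≋N i j = M≋N _ _

-- The block swap σ : b·p + a ↦ a·q + b, built from Fin (m * n) ↔ Fin m × Fin n: it
-- turns the index (block b, position a) of Fin (q * p) into (block a, position b).
blockSwap : ∀ p q → Permutation (q * p) (p * q)
blockSwap p q = ↔-trans (*↔× {q} {p}) (↔-trans (×-comm (Fin q) (Fin p)) (↔-sym (*↔× {p} {q})))

blockSwap-combine : ∀ p q (b : Fin q) (a : Fin p) → blockSwap p q ⟨$⟩ʳ combine b a ≡ combine a b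
blockSwap-combine p q b a = cong (uncurry combine ∘ swap) (remQuot-combine b a)

partialTranspose-blockSwap : ∀ p q (M : Mat (p * q)) →
  partialTranspose q p (relabel (blockSwap p q ⟨$⟩ʳ_) M) ≋
  relabel (blockSwap p q ⟨$⟩ʳ_) (transpose (partialTranspose p q M))
partialTranspose-blockSwap p q M = ≋-by-blocks {q} {p} on-blocks
  where
  open ≡-Reasoning
  σ : Fin (q * p) → Fin (p * q)
  σ = blockSwap p q ⟨$⟩ʳ_
  on-blocks : ∀ b a d c → partialTranspose q p (relabel σ M) (combine b a) (combine d c) ≡
                          partialTranspose p q M (σ (combine d c)) (σ (combine b a))
  on-blocks b a d c = begin
    partialTranspose q p (relabel σ M) (combine b a) (combine d c)
      ≡⟨ partialTranspose-combine q p (relabel σ M) b a d c ⟩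
    M (σ (combine b c)) (σ (combine d a))
      ≡⟨ cong₂ M (blockSwap-combine p q b c) (blockSwap-combine p q d a) ⟩
    M (combine c b) (combine a d)
      ≡⟨ partialTranspose-combine p q M c d a b ⟨
    partialTranspose p q M (combine c d) (combine a b)
      ≡⟨ cong₂ (partialTranspose p q M) (blockSwap-combine p q d c) (blockSwap-combine p q b a) ⟨
    partialTranspose p q M (σ (combine d c)) (σ (combine b a)) ∎

partialTranspose-blockSwap-isPermMat : ∀ p q (M : Mat (p * q)) →
  IsPermMat (partialTranspose q p (relabel (blockSwap p q ⟨$⟩ʳ_) M)) ⇔
  IsPermMat (partialTranspose p q M)
partialTranspose-blockSwap-isPermMat p q M = mk⇔
  (isPermMat-transpose ∘ relabel⁻ isPermMat-invariant (blockSwap p q)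
    ∘ respects isPermMat-invariant (partialTranspose-blockSwap p q M))
  (respects isPermMat-invariant (≋-sym (partialTranspose-blockSwap p q M))
    ∘ relabel⁺ isPermMat-invariant (blockSwap p q) ∘ isPermMat-transpose)

-- For a relabelling-invariant property S, the number of (pq)×(pq) matrices with
-- property S whose partial transpose Γ_p is a permutation matrix is symmetric in
-- p and q: relabelling along the block swap matches the two sets of matrices.
partialTranspose-count-symmetric : {S : ∀ {n} → Mat n → Set} → RelabellingInvariant S →
  (S? : ∀ {n} → Decidable (S {n})) → ∀ p q →
  length (filter (λ M → S? M ×-dec isPermMat? (partialTranspose p q M)) (allMats (p * q))) ≡
  length (filter (λ M → S? M ×-dec isPermMat? (partialTranspose q p M)) (allMats (q * p)))
partialTranspose-count-symmetric {S} S-inv S? p q = begin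
  length (filter Q-pq mats)               ≡⟨ length-filter Q-pq mats ⟩
  count Q-pq mats                         ≡⟨ count-cong Q-pq (Q-qp ∘ σ) blockSwap-matches mats ⟩
  count (Q-qp ∘ σ) mats                   ≡⟨ count-relabel Q-qp respects-≋ (blockSwap p q) ⟨
  count Q-qp (allMats (q * p))            ≡⟨ length-filter Q-qp (allMats (q * p)) ⟨
  length (filter Q-qp (allMats (q * p)))  ∎
  where
  open ≡-Reasoning
  mats : List (Mat (p * q))
  mats = allMats (p * q)
  σ : Mat (p * q) → Mat (q * p)
  σ = relabel (blockSwap p q ⟨$⟩ʳ_)
  Q-pq : Decidable (λ (M : Mat (p * q)) → S M × IsPermMat (partialTranspose p q M))
  Q-pq M = S? M ×-dec isPermMat? (partialTranspose p q M)
  Q-qp : Decidable (λ (M : Mat (q * p)) → S M × IsPermMat (partialTranspose q p M))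
  Q-qp M = S? M ×-dec isPermMat? (partialTranspose q p M)
  respects-≋ : {M N : Mat (q * p)} → M ≋ N →
               S M × IsPermMat (partialTranspose q p M) → S N × IsPermMat (partialTranspose q p N)
  respects-≋ M≋N (sM , permΓM) =
    respects S-inv M≋N sM , respects isPermMat-invariant (partialTranspose-cong q p M≋N) permΓM
  blockSwap-matches : ∀ M → (S M × IsPermMat (partialTranspose p q M)) ⇔
                            (S (σ M) × IsPermMat (partialTranspose q p (σ M)))
  blockSwap-matches M =
    ⇔-sym (relabel-⇔ S-inv (blockSwap p q) ×-⇔ partialTranspose-blockSwap-isPermMat p q M)

-- (i) and (iii) are the cases S = "permutation matrix" and S = "involution";
-- for (ii), Z_e(1,3) = 4 ≠ 6 = Z_e(3,1) is checked by evaluation.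
proposition1 : ((p q : ℕ) → 1 ≤ p → 1 ≤ q → Z p q ≡ Z q p)
               × (∃[ p ] ∃[ q ] (1 ≤ p × 1 ≤ q × Ze p q ≢ Ze q p))
               × ((p q : ℕ) → 1 ≤ p → 1 ≤ q → Zt p q ≡ Zt q p)
proposition1 =
  (λ p q _ _ → partialTranspose-count-symmetric isPermMat-invariant isPermMat? p q) ,
  (1 , 3 , s≤s z≤n , s≤s z≤n , λ ()) ,
  (λ p q _ _ → partialTranspose-count-symmetric isInvolution-invariant isInvolution? p q)
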